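{- For every integer $k\geq 1$ there is a polynomial $u_k(x)$, depending only on $k$, such that the following holds: for every $\mu\in\mathcal{BS}_\infty$ whose first $k$ entries $(\mu_1,\ldots,\mu_k)$ form a $k$-fuse, letting $\nu=(\mu_{k+1},\mu_{k+2},\ldots)$ be the barred sequence with the bars inherited from $\mu$, one has \[ g_\mu(x)=u_k(x)\,g_\nu(x). \]
   Context: A barred sequence is a sequence $\mu=(\mu_1,\mu_2,\ldots)$ of nonnegative integers together with a set of barred (playable) positions, only nonzero entries being barred. For a barred position $j$, the move $R_j$ gives $\mu'=R_j(\mu)$: if $j=1$, $\mu'_i=\mu_{i+1}$ for all $i$; if $j\geq 2$, $\mu'_i=\mu_i$ for $i<j-1$, $\mu'_{j-1}=\mu_{j-1}+\mu_j$, and $\mu'_i=\mu_{i+1}$ for $i\geq j$. The bars of $\mu'$: a position $i\le j-1$ is barred iff $\mu'_i\neq0$; a position $i\geq j$ is barred iff $\mu'_i\neq 0$ and $\sum_{r=j}^{i}\mu_r<3$. A legal move sequence from $\mu$ is a finite sequence $(j_1,\ldots,j_m)$ such that each $R_{j_t}$ is applied at a barred position of the current sequence; $g_\mu(x)=\sum x^m$ over all legal move sequences from $\mu$ (the level generating function of the tree $\mathcal{T}_\mu$ of elements reachable from $\mu$). The set $\mathcal{BS}_\infty$: for a primitive necklace $P$ (cyclic class of words in $\{B,W\}$, not a proper power) of length $n$ and $\ell\ge1$, let $\mathcal{O}_{P^\ell}$ be the Bulgarian Solitaire orbit of the necklace $P^\ell$ (partitions eventually mapped by Bulgarian Solitaire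 into the recurrent cycle corresponding to $P^\ell$); encode each $\lambda\in\mathcal{O}_{P^\ell}$ by $\mu_i=\lambda_i-\lambda_{i+1}$, with position $j$ barred iff $\mu_j\neq 0$ and $\lambda_j\geq(\text{number of nonzero parts of }\lambda)-1$. If there is an index $i$ such that no position among $i,\ldots,i+n-1$ is barred and $(\mu_i,\ldots,\mu_{i+n-1})=(a_1,\ldots,a_n)$, where for some rotation $(b_1,\ldots,b_n)$ of a word of $P$, $a_r=2$ if $b_rb_{r+1}=BW$, $a_r=1$ if $b_rb_{r+1}\in\{BB,WW\}$, $a_r=0$ if $b_rb_{r+1}=WB$ (indices mod $n$), then replacing $(\mu_{i+n},\mu_{i+n+1},\ldots)$ by infinitely many copies of $(\mu_i,\ldots,\mu_{i+n-1})$ (keeping the bars) gives an element of $\mathcal{BS}_\infty$; $\mathcal{BS}_\infty$ is the set of all elements so obtained. A $k$-fuse is a tuple $(\mu_1,\ldots,\mu_k)$ of entries of a barred sequence such that $\mu_1,\ldots,\mu_{k-1}\in\{1,2\}$, $\mu_k\geq 3$, positions $1,\ldots,k$ are all barred, and there are no $j\le k-1$ with $\mu_j=\mu_{j+1}=1$. -}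

module Defs where

open import Data.Nat.Base using (ℕ; zero; suc; _+_; _∸_; _<_; _≤_; _<ᵇ_; _≤ᵇ_; _≡ᵇ_; pred)
open import Data.Nat.DivMod using (_%_)
open import Data.Bool.Base using (Bool; true; false; not; _∧_; if_then_else_)
open import Data.List.Base using (List; []; _∷_; length; map; concat; replicate; drop; take; _++_; upTo)
open import Data.List.Membership.Propositional using (_∈_)
open import Data.List.Relation.Unary.Unique.Propositional using (Unique)
open import Data.Integer.Base as ℤ using (ℤ; +_)
open import Data.Product.Base using (Σ; ∃; _×_; _,_)
open import Relation.Binary.PropositionalEquality using (_≡_; _≢_)
open import Relation.Nullary.Negation using (¬_)
open import Function.Bundles using (_⇔_)

-- Conventions: all positions are 0-BASED.  Entry i of an Agda sequence
-- is the paper's entry μ_{i+1}; Agda move index j is the paper's R_{j+1}.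

record BarSeq : Set where
  constructor mkBS
  field
    seq : ℕ → ℕ
    bar : ℕ → Bool
open BarSeq public

nz : ℕ → Bool
nz n = not (n ≡ᵇ 0)

sumFrom : (ℕ → ℕ) → ℕ → ℕ → ℕ
sumFrom f j zero    = 0
sumFrom f j (suc c) = f j + sumFrom f (suc j) c

-- Σ_{r = j}^{i} f r   (used only when j ≤ i)
rangeSum : (ℕ → ℕ) → ℕ → ℕ → ℕ
rangeSum f j i = sumFrom f j (suc (i ∸ j))

moveSeq : ℕ → (ℕ → ℕ) → ℕ → ℕ
moveSeq j s i =
  if suc i <ᵇ j then s i
  else if suc i ≡ᵇ j then s i + s (suc i)
  else s (suc i)

move : ℕ → BarSeq → BarSeq
move j μ = mkBS s' b'
  where
  s' : ℕ → ℕ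
  s' = moveSeq j (seq μ)
  b' : ℕ → Bool
  b' i = if i <ᵇ j then nz (s' i)
         else (nz (s' i) ∧ (rangeSum (seq μ) j i <ᵇ 3))

data Legal : BarSeq → List ℕ → Set where
  done : ∀ {μ} → Legal μ []
  step : ∀ {μ j js} → bar μ j ≡ true → Legal (move j μ) js → Legal μ (j ∷ js)

-- The number of legal move sequences of length m from μ is c
-- (i.e. the coefficient of x^m in g_μ(x) is c): witnessed by a
-- duplicate-free list enumerating exactly these sequences.
LevelCount : BarSeq → ℕ → ℕ → Set
LevelCount μ m c =
  Σ (List (List ℕ)) λ L →
    Unique L × (∀ js → (js ∈ L) ⇔ (Legal μ js × length js ≡ m)) × length L ≡ c

-- Polynomials with integer coefficients as coefficient lists.
coeff : List ℤ → ℕ → ℤ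
coeff []       _       = + 0
coeff (a ∷ as) zero    = a
coeff (a ∷ as) (suc n) = coeff as n

-- Σ_{a=0}^{m} coeff u a * h (m - a)   (coefficient of x^m in u(x)·H(x))
convAux : List ℤ → (ℕ → ℕ) → ℕ → ℕ → ℤ
convAux u h m zero    = ℤ._*_ (coeff u 0) (+ h m)
convAux u h m (suc a) = ℤ._+_ (ℤ._*_ (coeff u (suc a)) (+ h (m ∸ suc a))) (convAux u h m a)

conv : List ℤ → (ℕ → ℕ) → ℕ → ℤ
conv u h m = convAux u h m m

insertDesc : ℕ → List ℕ → List ℕ
insertDesc x [] = x ∷ []
insertDesc x (y ∷ ys) = if y <ᵇ x then x ∷ y ∷ ys else y ∷ insertDesc x ys

sortDesc : List ℕ → List ℕ
sortDesc [] = []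
sortDesc (x ∷ xs) = insertDesc x (sortDesc xs)

dropZeros : List ℕ → List ℕ
dropZeros [] = []
dropZeros (zero ∷ xs) = dropZeros xs
dropZeros (suc x ∷ xs) = suc x ∷ dropZeros xs

bulgarian : List ℕ → List ℕ
bulgarian λ' = sortDesc (dropZeros (length λ' ∷ map pred λ'))

iterate : ℕ → (List ℕ → List ℕ) → List ℕ → List ℕ
iterate zero f x = x
iterate (suc t) f x = f (iterate t f x)

data Decreasing : List ℕ → Set where
  dnil  : Decreasing []
  done₁ : ∀ {x} → Decreasing (x ∷ [])
  dcons : ∀ {x y ys} → y ≤ x → Decreasing (y ∷ ys) → Decreasing (x ∷ y ∷ ys)

data AllPos : List ℕ → Set where
  pnil  : AllPos []
  pcons : ∀ {x xs} → 0 < x → AllPos xs → AllPos (x ∷ xs)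

IsPartition : List ℕ → Set
IsPartition λ' = Decreasing λ' × AllPos λ'

-- Words / necklaces in {B, W}:  B = true, W = false.
Word : Set
Word = List Bool

IsRotation : Word → Word → Set
IsRotation b w = ∃ λ k → b ≡ drop k w ++ take k w

power : ℕ → Word → Word
power ℓ w = concat (replicate ℓ w)

Primitive : Word → Set
Primitive P = 0 < length P × ¬ (Σ Word λ q → Σ ℕ λ d → 2 ≤ d × P ≡ power d q)

bit : Bool → ℕ
bit true = 1
bit false = 0

-- The recurrent partition whose last (partial) diagonal, of length d, is
-- read from the word w (row a, a = 1..d, of the diagonal contains a cell
-- iff w_a = B):  λ_a = d - a + [w_a = B].
recRaw : Word → List ℕ
recRaw [] = []
recRaw (b ∷ w) = (length w + bit b) ∷ recRaw w

recPart : Word → List ℕ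
recPart w = dropZeros (recRaw w)

-- The Bulgarian solitaire orbit O_{P^ℓ}: partitions eventually mapped
-- into the recurrent cycle { recPart w | w a rotation of P^ℓ }.
InOrbit : Word → ℕ → List ℕ → Set
InOrbit P ℓ λ' = IsPartition λ' ×
  (Σ ℕ λ t → Σ Word λ w → IsRotation w (power ℓ P) × iterate t bulgarian λ' ≡ recPart w)

lk : List ℕ → ℕ → ℕ
lk [] _ = 0
lk (x ∷ xs) zero = x
lk (x ∷ xs) (suc i) = lk xs i

encSeq : List ℕ → ℕ → ℕ
encSeq λ' i = lk λ' i ∸ lk λ' (suc i)

encBar : List ℕ → ℕ → Bool
encBar λ' j = nz (encSeq λ' j) ∧ (length λ' ≤ᵇ lk λ' j + 1)

aval : Bool → Bool → ℕ
aval true false = 2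
aval false true = 0
aval true true = 1
aval false false = 1

zipA : Word → Word → List ℕ
zipA (x ∷ xs) (y ∷ ys) = aval x y ∷ zipA xs ys
zipA _ _ = []

aWord : Word → List ℕ
aWord [] = []
aWord (b ∷ bs) = zipA (b ∷ bs) (bs ++ (b ∷ []))

splice : List ℕ → ℕ → ℕ → BarSeq
splice λ' i m = mkBS s b
  where
  s : ℕ → ℕ
  s p = if p <ᵇ i then encSeq λ' p else encSeq λ' (i + ((p ∸ i) % suc m))
  b : ℕ → Bool
  b p = if p <ᵇ i then encBar λ' p else false

InBSinf : BarSeq → Set
InBSinf μ =
  Σ Word λ P → Σ ℕ λ m → length P ≡ suc m × Primitive P ×
  Σ ℕ λ ℓ → 1 ≤ ℓ ×
  Σ (List ℕ) λ λ' → InOrbit P ℓ λ' ×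
  Σ ℕ λ i → Σ Word λ b → IsRotation b P ×
    (∀ r → r < suc m → encBar λ' (i + r) ≡ false) ×
    map (λ r → encSeq λ' (i + r)) (upTo (suc m)) ≡ aWord b ×
    (∀ p → seq μ p ≡ seq (splice λ' i m) p) ×
    (∀ p → bar μ p ≡ bar (splice λ' i m) p)

IsFuse : ℕ → BarSeq → Set
IsFuse k μ =
  (∀ t → suc t < k → (seq μ t ≡ 1 ⊎' seq μ t ≡ 2)) ×
  3 ≤ seq μ (k ∸ 1) ×
  (∀ t → t < k → bar μ t ≡ true) ×
  (∀ t → suc t < k → ¬ (seq μ t ≡ 1 × seq μ (suc t) ≡ 1))
  where
  open import Data.Sum.Base renaming (_⊎_ to _⊎'_)

dropBS : ℕ → BarSeq → BarSeq
dropBS k μ = mkBS (λ i → seq μ (k + i)) (λ i → bar μ (k + i))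

{-# OPTIONS --safe #-}
module Submission where

-- Classify legal move sequences from μ by their first move (positions are 0-based).  A move at
-- position k + j, inside ν, keeps μ a k-fuse and acts on ν as the move at j.  A move at a position
-- j < k of the fuse leaves a j-fuse followed by a chain of length k - 1 - j: behind the move the
-- running sums reach 3 within two entries (no 11 in a fuse, last entry ≥ 3), so at most the entry right
-- after it stays barred, and ν is never reached again.  A chain of length r contributes 1 + x + ⋯ + xʳ,
-- so by induction on k and on the level, g_μ = u_k g_ν where u_0 = 1 and
-- u_k = 1 + x Σ_{j<k} u_j (1 + x + ⋯ + x^{k-1-j}), a polynomial of degree at most k.
-- The level counts exist because an element of BS∞ has finitely many bars and a nonzero entry in every
-- period, so a move creates bars only within a bounded distance of itself.

open import Defs
open import Data.Nat.Base using (ℕ; _≤_)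
open import Data.Integer.Base using (ℤ; +_)
open import Data.List.Base using (List)
open import Data.Product.Base using (Σ; _×_)
open import Relation.Binary.PropositionalEquality using (_≡_)

open import Data.Nat.Base using (zero; suc; _+_; _*_; _∸_; _<_; _<ᵇ_; _≡ᵇ_; z≤n; s≤s)
open import Data.Nat.Properties
open import Data.Nat.Induction using (<-rec)
open import Data.Nat.DivMod using (_%_; _/_; m≡m%n+[m/n]*n; m%n<n; [m+kn]%n≡m%n; m<n⇒m%n≡m)
open import Data.Nat.ListAction using (sum)
open import Data.Nat.ListAction.Properties using (sum-++)
open import Data.Nat.Solver using (module +-*-Solver)
open import Data.Bool.Base using (Bool; true; false; _∧_; if_then_else_)
open import Data.Bool.Properties using (T-≡; T-∧; ∧-zeroʳ) renaming (_≟_ to _≟ᵇ_)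
open import Data.List.Base using ([]; _∷_; length; map; _++_; upTo; filter; downFrom; applyUpTo)
open import Data.List.Properties using (∷-injectiveˡ; ∷-injectiveʳ; length-++; length-map; map-++; map-∘; map-cong-local)
open import Data.List.Membership.Propositional using (_∈_)
open import Data.List.Membership.Propositional.Properties
open import Data.List.Membership.Propositional.Properties.WithK using (unique∧set⇒bag)
open import Data.List.Relation.Binary.BagAndSetEquality using (∼bag⇒↭)
open import Data.List.Relation.Binary.Permutation.Propositional.Properties using (↭-length)
open import Data.List.Relation.Unary.All as All using ([]; _∷_)
open import Data.List.Relation.Unary.Any using (here; there)
open import Data.List.Relation.Unary.AllPairs using ([]; _∷_)
open import Data.List.Relation.Unary.Unique.Propositional using (Unique)
import Data.List.Relation.Unary.Unique.Propositional.Properties as Unique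
open import Data.Product.Base using (_,_; proj₁; proj₂; ∃; ∃₂)
import Data.Integer.Base as ℤ
open import Data.Integer.Properties using (pos-+; pos-*)
open import Data.Sum.Base using (_⊎_; inj₁; inj₂)
open import Data.Empty using (⊥-elim)
open import Data.Unit.Base using (⊤; tt)
open import Relation.Nullary using (¬_; Dec; yes; no)
open import Relation.Binary.PropositionalEquality using (_≢_; refl; sym; trans; cong; cong₂; subst; subst₂; module ≡-Reasoning)
open import Function.Base using (_∘_; case_of_)
open import Function.Bundles using (_⇔_; mk⇔; Equivalence)
import Function.Properties.Equivalence as ⇔
open Equivalence using (to; from)

-- Counting legal move sequences

_≋_ : BarSeq → BarSeq → Set
μ ≋ ν = (∀ i → seq μ i ≡ seq ν i) × (∀ i → bar μ i ≡ bar ν i)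

≋-sym : ∀ {μ ν} → μ ≋ ν → ν ≋ μ
≋-sym (s , b) = sym ∘ s , sym ∘ b

sumFrom-cong : ∀ {f g : ℕ → ℕ} → (∀ i → f i ≡ g i) → ∀ j c → sumFrom f j c ≡ sumFrom g j c
sumFrom-cong f≗g j zero    = refl
sumFrom-cong f≗g j (suc c) = cong₂ _+_ (f≗g j) (sumFrom-cong f≗g (suc j) c)

moveSeq-cong : ∀ {f g : ℕ → ℕ} → (∀ i → f i ≡ g i) → ∀ j i → moveSeq j f i ≡ moveSeq j g i
moveSeq-cong f≗g j i =
  cong₂ (λ a b → if suc i <ᵇ j then a else if suc i ≡ᵇ j then a + b else b) (f≗g i) (f≗g (suc i))

move-cong : ∀ {μ ν} → μ ≋ ν → ∀ j → move j μ ≋ move j ν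
move-cong (s , _) j = moveSeq-cong s j , λ i →
  cong₂ (λ a r → if i <ᵇ j then nz a else (nz a ∧ (r <ᵇ 3)))
    (moveSeq-cong s j i) (sumFrom-cong s j (suc (i ∸ j)))

Legal-cong : ∀ {μ ν js} → μ ≋ ν → Legal μ js → Legal ν js
Legal-cong e done               = done
Legal-cong e (step {j = j} b l) = step (trans (sym (proj₂ e j)) b) (Legal-cong (move-cong e j) l)

LevelCount-cong : ∀ {μ ν m c} → μ ≋ ν → LevelCount μ m c → LevelCount ν m c
LevelCount-cong e (L , u , L⇔ , len) =
  L , u , (λ js → mk⇔ (λ p → let l , n = to (L⇔ js) p in Legal-cong e l , n)
                      (λ (l , n) → from (L⇔ js) (Legal-cong (≋-sym e) l , n))) , len

LevelCount-zero : ∀ μ → LevelCount μ 0 1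
LevelCount-zero μ = [] ∷ [] , [] ∷ [] , (λ js → mk⇔ legal listed) , refl
  where
  legal : ∀ {js} → js ∈ [] ∷ [] → Legal μ js × length js ≡ 0
  legal (here refl) = done , refl
  listed : ∀ {js} → Legal μ js × length js ≡ 0 → js ∈ [] ∷ []
  listed (done , _) = here refl

LevelCount-unique : ∀ {μ m c c′} → LevelCount μ m c → LevelCount μ m c′ → c ≡ c′
LevelCount-unique (L , u , L⇔ , refl) (L′ , u′ , L′⇔ , refl) =
  ↭-length (∼bag⇒↭ (unique∧set⇒bag u u′ λ {js} → ⇔.trans (L⇔ js) (⇔.sym (L′⇔ js))))

FirstMoveIn : List ℕ → BarSeq → ℕ → List ℕ → Set
FirstMoveIn J ρ m js = ∃₂ λ j t → j ∈ J × js ≡ j ∷ t × Legal (move j ρ) t × length t ≡ m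

enumerate-FirstMoveIn : ∀ ρ m (c : ℕ → ℕ) (J : List ℕ) → Unique J →
  (∀ j → j ∈ J → LevelCount (move j ρ) m (c j)) →
  Σ (List (List ℕ)) λ L → Unique L × (∀ js → js ∈ L ⇔ FirstMoveIn J ρ m js) × length L ≡ sum (map c J)
enumerate-FirstMoveIn ρ m c [] _ _ = [] , [] , (λ js → mk⇔ (λ ()) λ ()) , refl
enumerate-FirstMoveIn ρ m c (j ∷ J) (j∉J ∷ uJ) count
  with Lj , uj , Lj⇔ , lenj ← count j (here refl)
     | L , uL , L⇔ , len ← enumerate-FirstMoveIn ρ m c J uJ (λ i i∈J → count i (there i∈J))
  = map (j ∷_) Lj ++ L , unique , (λ js → mk⇔ (sound js) (complete js)) , length-eq
  where
  disjoint : ∀ {js} → ¬ (js ∈ map (j ∷_) Lj × js ∈ L)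
  disjoint (p , q) with map∷⁻ p | to (L⇔ _) q
  ... | _ , _ , refl | _ , _ , i∈J , refl , _ = All.lookup j∉J i∈J refl
  unique : Unique (map (j ∷_) Lj ++ L)
  unique = Unique.++⁺ (Unique.map⁺ ∷-injectiveʳ uj) uL disjoint
  sound : ∀ js → js ∈ map (j ∷_) Lj ++ L → FirstMoveIn (j ∷ J) ρ m js
  sound js p with ∈-++⁻ (map (j ∷_) Lj) p
  ... | inj₁ q with t , t∈Lj , eq ← map∷⁻ q = j , t , here refl , eq , to (Lj⇔ t) t∈Lj
  ... | inj₂ q with i , t , i∈J , rest ← to (L⇔ js) q = i , t , there i∈J , rest
  complete : ∀ js → FirstMoveIn (j ∷ J) ρ m js → js ∈ map (j ∷_) Lj ++ L
  complete _ (_ , t , here refl , refl , l , n) = ∈-++⁺ˡ (∈-map⁺ (j ∷_) (from (Lj⇔ t) (l , n)))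
  complete js (i , t , there i∈J , rest) = ∈-++⁺ʳ (map (j ∷_) Lj) (from (L⇔ js) (i , t , i∈J , rest))
  length-eq : length (map (j ∷_) Lj ++ L) ≡ c j + sum (map c J)
  length-eq = trans (length-++ (map (j ∷_) Lj)) (cong₂ _+_ (trans (length-map (j ∷_) Lj) lenj) len)

Enumerates : List ℕ → (ℕ → Bool) → Set
Enumerates J b = Unique J × (∀ j → j ∈ J ⇔ (b j ≡ true))

LevelCount-suc : ∀ ρ m (c : ℕ → ℕ) (J : List ℕ) → Enumerates J (bar ρ) →
  (∀ j → j ∈ J → LevelCount (move j ρ) m (c j)) → LevelCount ρ (suc m) (sum (map c J))
LevelCount-suc ρ m c J (uJ , J⇔) count
  with L , uL , L⇔ , len ← enumerate-FirstMoveIn ρ m c J uJ count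
  = L , uL , (λ js → mk⇔ (sound js) (complete js)) , len
  where
  sound : ∀ js → js ∈ L → Legal ρ js × length js ≡ suc m
  sound js p with j , t , j∈J , refl , l , refl ← to (L⇔ js) p = step (to (J⇔ j) j∈J) l , refl
  complete : ∀ js → Legal ρ js × length js ≡ suc m → js ∈ L
  complete (j ∷ t) (step b l , n) =
    from (L⇔ (j ∷ t)) (j , t , from (J⇔ j) b , refl , l , suc-injective n)

finite-choice : ∀ {A : Set} {P : ℕ → A → Set} → A → (J : List ℕ) →
  (∀ j → j ∈ J → Σ A (P j)) → Σ (ℕ → A) λ c → ∀ j → j ∈ J → P j (c j)
finite-choice a [] _ = (λ _ → a) , λ _ ()
finite-choice {A} {P} a (j ∷ J) choice
  with x , px ← choice j (here refl)
     | c , pc ← finite-choice a J (λ i i∈J → choice i (there i∈J))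
  = c′ , pc′
  where
  c′ : ℕ → A
  c′ i with i ≟ j
  ... | yes _ = x
  ... | no  _ = c i
  pc′ : ∀ i → i ∈ j ∷ J → P i (c′ i)
  pc′ i i∈ with i ≟ j | i∈
  ... | yes refl | _          = px
  ... | no  i≢j  | here i≡j   = ⊥-elim (i≢j i≡j)
  ... | no  _    | there i∈J = pc i i∈J

FinitelyBranching : ℕ → BarSeq → Set
FinitelyBranching zero    ρ = ⊤
FinitelyBranching (suc m) ρ = Σ (List ℕ) λ J → Enumerates J (bar ρ) ×
  (∀ j → bar ρ j ≡ true → FinitelyBranching m (move j ρ))

levelCount : ∀ m ρ → FinitelyBranching m ρ → Σ ℕ (LevelCount ρ m)
levelCount zero    ρ _ = 1 , LevelCount-zero ρ
levelCount (suc m) ρ (J , enum , branch)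
  with c , count ← finite-choice 0 J (λ j j∈J →
                      levelCount m (move j ρ) (branch j (to (proj₂ enum j) j∈J)))
  = sum (map c J) , LevelCount-suc ρ m c J enum count

FinitelyBranching-cong : ∀ m {ρ ρ′} → ρ ≋ ρ′ → FinitelyBranching m ρ → FinitelyBranching m ρ′
FinitelyBranching-cong zero    e _ = tt
FinitelyBranching-cong (suc m) e (J , (uJ , J⇔) , branch) =
  J , (uJ , λ j → ⇔.trans (J⇔ j) (mk⇔ (trans (sym (proj₂ e j))) (trans (proj₂ e j)))) ,
  λ j b → FinitelyBranching-cong m (move-cong e j) (branch j (trans (proj₂ e j) b))

-- Moves

<ᵇ-true : ∀ {m n} → m < n → (m <ᵇ n) ≡ true
<ᵇ-true m<n = to T-≡ (<⇒<ᵇ m<n)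

<ᵇ-false : ∀ {m n} → n ≤ m → (m <ᵇ n) ≡ false
<ᵇ-false {m} {n} n≤m with m <ᵇ n in eq
... | false = refl
... | true  = ⊥-elim (<⇒≱ (<ᵇ⇒< m n (from T-≡ eq)) n≤m)

≡ᵇ-false : ∀ {m n} → m ≢ n → (m ≡ᵇ n) ≡ false
≡ᵇ-false {m} {n} m≢n with m ≡ᵇ n in eq
... | false = refl
... | true  = ⊥-elim (m≢n (≡ᵇ⇒≡ m n (from T-≡ eq)))

if-true : ∀ {A : Set} {c} {a b : A} → c ≡ true → (if c then a else b) ≡ a
if-true refl = refl

if-false : ∀ {A : Set} {c} {a b : A} → c ≡ false → (if c then a else b) ≡ b
if-false refl = refl

moveSeq-cases : ∀ j (s : ℕ → ℕ) i {a b} → (suc i <ᵇ j) ≡ a → (suc i ≡ᵇ j) ≡ b →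
  moveSeq j s i ≡ (if a then s i else if b then s i + s (suc i) else s (suc i))
moveSeq-cases j s i refl refl = refl

moveSeq-before : ∀ j (s : ℕ → ℕ) i → suc i < j → moveSeq j s i ≡ s i
moveSeq-before j s i i+1<j = moveSeq-cases j s i (<ᵇ-true i+1<j) refl

moveSeq-at : ∀ (s : ℕ → ℕ) i → moveSeq (suc i) s i ≡ s i + s (suc i)
moveSeq-at s i =
  moveSeq-cases (suc i) s i (<ᵇ-false {suc i} ≤-refl) (to T-≡ (≡⇒≡ᵇ (suc i) (suc i) refl))

moveSeq-after : ∀ j (s : ℕ → ℕ) i → j ≤ i → moveSeq j s i ≡ s (suc i)
moveSeq-after j s i j≤i =
  moveSeq-cases j s i (<ᵇ-false (m≤n⇒m≤1+n j≤i)) (≡ᵇ-false (<⇒≢ (s≤s j≤i) ∘ sym))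

bar-move-cases : ∀ j μ i {a} → (i <ᵇ j) ≡ a → bar (move j μ) i ≡
  (if a then nz (moveSeq j (seq μ) i) else (nz (moveSeq j (seq μ) i) ∧ (rangeSum (seq μ) j i <ᵇ 3)))
bar-move-cases j μ i refl = refl

bar-move-before : ∀ j μ i → i < j → bar (move j μ) i ≡ nz (moveSeq j (seq μ) i)
bar-move-before j μ i i<j = bar-move-cases j μ i (<ᵇ-true i<j)

bar-move-after : ∀ j μ i → j ≤ i →
  bar (move j μ) i ≡ (nz (seq μ (suc i)) ∧ (rangeSum (seq μ) j i <ᵇ 3))
bar-move-after j μ i j≤i = trans (bar-move-cases j μ i (<ᵇ-false j≤i))
  (cong (λ a → nz a ∧ (rangeSum (seq μ) j i <ᵇ 3)) (moveSeq-after j (seq μ) i j≤i))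

bar-move-after-false : ∀ j μ i → j ≤ i → 3 ≤ rangeSum (seq μ) j i → bar (move j μ) i ≡ false
bar-move-after-false j μ i j≤i 3≤sum rewrite bar-move-after j μ i j≤i | <ᵇ-false 3≤sum = ∧-zeroʳ _

nz-pos : ∀ {x} → 1 ≤ x → nz x ≡ true
nz-pos {suc x} _ = refl

sumFrom-+ : ∀ (f : ℕ → ℕ) a c d → sumFrom f a (c + d) ≡ sumFrom f a c + sumFrom f (a + c) d
sumFrom-+ f a zero    d = cong (λ x → sumFrom f x d) (sym (+-identityʳ a))
sumFrom-+ f a (suc c) d = begin
  f a + sumFrom f (suc a) (c + d)                        ≡⟨ cong (λ x → f a + x) (sumFrom-+ f (suc a) c d) ⟩
  f a + (sumFrom f (suc a) c + sumFrom f (suc a + c) d)  ≡⟨ sym (+-assoc (f a) _ _) ⟩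
  f a + sumFrom f (suc a) c + sumFrom f (suc a + c) d
    ≡⟨ cong (λ x → f a + sumFrom f (suc a) c + sumFrom f x d) (sym (+-suc a c)) ⟩
  f a + sumFrom f (suc a) c + sumFrom f (a + suc c) d    ∎
  where open ≡-Reasoning

sumFrom-≥-term : ∀ (f : ℕ → ℕ) a c q → a ≤ q → q < a + c → f q ≤ sumFrom f a c
sumFrom-≥-term f a zero    q a≤q q<a+0 = ⊥-elim (<⇒≱ q<a+0 (subst (_≤ q) (sym (+-identityʳ a)) a≤q))
sumFrom-≥-term f a (suc c) q a≤q q<a+c with a ≟ q
... | yes refl = m≤m+n (f a) _
... | no  a≢q  = ≤-trans (sumFrom-≥-term f (suc a) c q (≤∧≢⇒< a≤q a≢q) (subst (q <_) (+-suc a c) q<a+c))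
                         (m≤n+m _ (f a))

sumFrom-mono : ∀ (f : ℕ → ℕ) a {c d} → c ≤ d → sumFrom f a c ≤ sumFrom f a d
sumFrom-mono f a {c} c≤d = subst (sumFrom f a c ≤_)
  (trans (sym (sumFrom-+ f a c _)) (cong (sumFrom f a) (m+[n∸m]≡n c≤d))) (m≤m+n _ _)

-- Finite branching in BS∞

Dense : ℕ → (ℕ → ℕ) → Set
Dense D f = ∀ p → ∃ λ q → p ≤ q × q < p + D × 1 ≤ f q

Dense⇒sumFrom-≥ : ∀ {D f} → Dense D f → ∀ t a → t ≤ sumFrom f a (t * D)
Dense⇒sumFrom-≥ dense zero    a = z≤n
Dense⇒sumFrom-≥ {D} {f} dense (suc t) a with q , a≤q , q<a+D , fq>0 ← dense a =
  subst (suc t ≤_) (sym (sumFrom-+ f a D (t * D)))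
    (+-mono-≤ (≤-trans fq>0 (sumFrom-≥-term f a D q a≤q q<a+D)) (Dense⇒sumFrom-≥ dense t (a + D)))

moveSeq-≥-here : ∀ j (s : ℕ → ℕ) i → i < j → s i ≤ moveSeq j s i
moveSeq-≥-here j s i i<j with m≤n⇒m<n∨m≡n i<j
... | inj₁ i+1<j = ≤-reflexive (sym (moveSeq-before j s i i+1<j))
... | inj₂ refl  = subst (s i ≤_) (sym (moveSeq-at s i)) (m≤m+n _ _)

moveSeq-≥-next : ∀ j (s : ℕ → ℕ) i → j ≤ suc i → s (suc i) ≤ moveSeq j s i
moveSeq-≥-next j s i j≤i+1 with m≤n⇒m<n∨m≡n j≤i+1
... | inj₁ j<i+1 = ≤-reflexive (sym (moveSeq-after j s i (≤-pred j<i+1)))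
... | inj₂ refl  = subst (s (suc i) ≤_) (sym (moveSeq-at s i)) (m≤n+m _ _)

Dense-move : ∀ {D} {s : ℕ → ℕ} → Dense D s → ∀ j → Dense D (moveSeq j s)
Dense-move {D} {s} dense j p with j ≤? p
... | yes j≤p with dense (suc p)
...   | suc q , p<q+1 , q+1<p+1+D , s>0 =
        q , ≤-pred p<q+1 , ≤-pred q+1<p+1+D ,
        ≤-trans s>0 (moveSeq-≥-next j s q (≤-trans j≤p (≤-trans (≤-pred p<q+1) (n≤1+n q))))
Dense-move {D} {s} dense j p | no j≰p with dense p
... | q , p≤q , q<p+D , s>0 with q <? j
...   | yes q<j = q , p≤q , q<p+D , ≤-trans s>0 (moveSeq-≥-here j s q q<j)
...   | no  q≮j = shiftBack q q<p+D s>0 (≮⇒≥ q≮j)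
  where
  shiftBack : ∀ q → q < p + D → 1 ≤ s q → j ≤ q → ∃ λ q′ → p ≤ q′ × q′ < p + D × 1 ≤ moveSeq j s q′
  shiftBack zero    _         _   j≤0   = ⊥-elim (j≰p (≤-trans j≤0 z≤n))
  shiftBack (suc q) q+1<p+D s>0 j≤q+1 = q , ≤-pred (≤-trans (≰⇒> j≰p) j≤q+1) , <-trans (n<1+n q) q+1<p+D ,
    ≤-trans s>0 (moveSeq-≥-next j s q j≤q+1)

BarsBelow : ℕ → BarSeq → Set
BarsBelow B ρ = ∀ j → bar ρ j ≡ true → j < B

bar-move-near : ∀ {D} ρ j i → Dense D (seq ρ) → bar (move j ρ) i ≡ true → i < j + 3 * D
bar-move-near {D} ρ j i dense barred with i <? j + 3 * D
... | yes i<j+3D = i<j+3D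
... | no  i≮j+3D = ⊥-elim (<⇒≢ (≤-<-trans three≤sum sum<3) refl)
  where
  j≤i : j ≤ i
  j≤i = ≤-trans (m≤m+n j (3 * D)) (≮⇒≥ i≮j+3D)
  3D≤length : 3 * D ≤ suc (i ∸ j)
  3D≤length = ≤-trans (subst (_≤ i ∸ j) (m+n∸m≡n j (3 * D)) (∸-monoˡ-≤ j (≮⇒≥ i≮j+3D))) (n≤1+n _)
  three≤sum : 3 ≤ rangeSum (seq ρ) j i
  three≤sum = ≤-trans (Dense⇒sumFrom-≥ dense 3 j) (sumFrom-mono (seq ρ) j 3D≤length)
  sum<3 : rangeSum (seq ρ) j i < 3
  sum<3 = <ᵇ⇒< _ 3 (proj₂ (to T-∧ (from T-≡ (trans (sym (bar-move-after j ρ i j≤i)) barred))))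

BarsBelow-move : ∀ {D B ρ j} → Dense D (seq ρ) → BarsBelow B ρ → bar ρ j ≡ true →
  BarsBelow (B + 3 * D) (move j ρ)
BarsBelow-move {D} {ρ = ρ} {j} dense below barred i barred′ =
  <-≤-trans (bar-move-near ρ j i dense barred′) (+-monoˡ-≤ (3 * D) (<⇒≤ (below j barred)))

Dense∧BarsBelow⇒FinitelyBranching : ∀ {D} m B ρ → Dense D (seq ρ) → BarsBelow B ρ →
  FinitelyBranching m ρ
Dense∧BarsBelow⇒FinitelyBranching zero B ρ _ _ = tt
Dense∧BarsBelow⇒FinitelyBranching {D} (suc m) B ρ dense below =
  J , (Unique.filter⁺ barred? (Unique.upTo⁺ B) , J⇔) ,
  λ j b → Dense∧BarsBelow⇒FinitelyBranching m (B + 3 * D) (move j ρ)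
            (Dense-move dense j) (BarsBelow-move dense below b)
  where
  barred? : ∀ j → Dec (bar ρ j ≡ true)
  barred? j = bar ρ j ≟ᵇ true
  J : List ℕ
  J = filter barred? (upTo B)
  J⇔ : ∀ j → j ∈ J ⇔ (bar ρ j ≡ true)
  J⇔ j = mk⇔ (proj₂ ∘ ∈-filter⁻ barred? {xs = upTo B}) (λ b → ∈-filter⁺ barred? (∈-upTo⁺ (below j b)) b)

aval-diagonal-pos : ∀ x → 1 ≤ aval x x
aval-diagonal-pos true  = s≤s z≤n
aval-diagonal-pos false = s≤s z≤n

aval-B-pos : ∀ y → 1 ≤ aval true y
aval-B-pos true  = s≤s z≤n
aval-B-pos false = s≤s z≤n

aWord-second-pos : ∀ n (g : ℕ → ℕ) b → map g (upTo (suc n)) ≡ aWord b → g 0 ≡ 0 → 1 < suc n × 1 ≤ g 1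
aWord-second-pos n g (x ∷ []) eq g0≡0 =
  ⊥-elim (<⇒≢ (aval-diagonal-pos x) (trans (sym g0≡0) (∷-injectiveˡ eq)))
aWord-second-pos n g (true ∷ y ∷ bs) eq g0≡0 =
  ⊥-elim (<⇒≢ (aval-B-pos y) (trans (sym g0≡0) (∷-injectiveˡ eq)))
aWord-second-pos n g (false ∷ false ∷ bs) eq g0≡0 =
  ⊥-elim (<⇒≢ (s≤s z≤n) (trans (sym g0≡0) (∷-injectiveˡ eq)))
aWord-second-pos zero g (false ∷ true ∷ []) eq _ with () ← ∷-injectiveʳ eq
aWord-second-pos zero g (false ∷ true ∷ c ∷ bs) eq _ with () ← ∷-injectiveʳ eq
aWord-second-pos (suc n) g (false ∷ true ∷ []) eq _ =
  s≤s (s≤s z≤n) , subst (1 ≤_) (sym (∷-injectiveˡ (∷-injectiveʳ eq))) (aval-B-pos false)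
aWord-second-pos (suc n) g (false ∷ true ∷ c ∷ bs) eq _ =
  s≤s (s≤s z≤n) , subst (1 ≤_) (sym (∷-injectiveˡ (∷-injectiveʳ eq))) (aval-B-pos c)

aWord-nonzero : ∀ n (g : ℕ → ℕ) b → map g (upTo (suc n)) ≡ aWord b → ∃ λ r → r < suc n × 1 ≤ g r
aWord-nonzero n g b eq with g 0 ≟ 0
... | no  g0≢0 = 0 , s≤s z≤n , n≢0⇒n>0 g0≢0
... | yes g0≡0 = 1 , aWord-second-pos n g b eq g0≡0

periodic-Dense : ∀ {f : ℕ → ℕ} i r n → r < suc n → (∀ t → 1 ≤ f (i + (r + t * suc n))) →
  Dense (i + 2 * suc n) f
periodic-Dense i r n r<n pos p = q , p≤q , q<p+D , pos (suc (p / suc n))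
  where
  N = suc n
  X = (p / N) * N
  q = i + (r + suc (p / N) * N)
  p≡ : p ≡ p % N + X
  p≡ = m≡m%n+[m/n]*n p N
  p≤q : p ≤ q
  p≤q = ≤-trans (≤-trans (≤-reflexive p≡) (<⇒≤ (+-monoˡ-< X (m%n<n p N))))
           (≤-trans (m≤n+m _ r) (m≤n+m _ i))
  X≤p : X ≤ p
  X≤p = subst (X ≤_) (sym p≡) (m≤n+m X _)
  q<p+D : q < p + (i + 2 * N)
  q<p+D = subst (q <_) (solve 3 (λ i n p → i :+ (n :+ (n :+ p)) := p :+ (i :+ (con 2 :* n))) refl i N p)
            (+-monoʳ-< i (+-mono-<-≤ r<n (+-monoʳ-≤ N X≤p)))
    where open +-*-Solver

Dense-drop : ∀ {D f} → Dense D f → ∀ k → Dense D (λ i → f (k + i))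
Dense-drop {D} {f} dense k p with q , k+p≤q , q<k+p+D , fq>0 ← dense (k + p) =
  q ∸ k , p≤q∸k , q∸k<p+D , subst (1 ≤_) (cong f (sym k+[q∸k]≡q)) fq>0
  where
  k+[q∸k]≡q : k + (q ∸ k) ≡ q
  k+[q∸k]≡q = m+[n∸m]≡n (≤-trans (m≤m+n k p) k+p≤q)
  p≤q∸k : p ≤ q ∸ k
  p≤q∸k = +-cancelˡ-≤ k p (q ∸ k) (subst (k + p ≤_) (sym k+[q∸k]≡q) k+p≤q)
  q∸k<p+D : q ∸ k < p + D
  q∸k<p+D = +-cancelˡ-< k (q ∸ k) (p + D)
    (subst (_< k + (p + D)) (sym k+[q∸k]≡q) (subst (q <_) (+-assoc k p D) q<k+p+D))

BarsBelow-drop : ∀ {B μ} → BarsBelow B μ → ∀ k → BarsBelow B (dropBS k μ)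
BarsBelow-drop below k p barred = ≤-<-trans (m≤n+m p k) (below (k + p) barred)

BSinf⇒Dense∧BarsBelow : ∀ μ → InBSinf μ → ∃₂ λ D B → Dense D (seq μ) × BarsBelow B μ
BSinf⇒Dense∧BarsBelow μ (_ , n , _ , _ , _ , _ , λ′ , _ , i , b , _ , _ , period≡aWord , seq≡ , bar≡)
  with r , r<n , nonzero ← aWord-nonzero n (λ r → encSeq λ′ (i + r)) b period≡aWord
  = i + 2 * suc n , i , periodic-Dense i r n r<n repeated , below
  where
  repeated : ∀ t → 1 ≤ seq μ (i + (r + t * suc n))
  repeated t = subst (1 ≤_) (sym periodic) nonzero
    where
    residue : (i + (r + t * suc n) ∸ i) % suc n ≡ r
    residue = trans (cong (_% suc n) (m+n∸m≡n i (r + t * suc n)))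
                    (trans ([m+kn]%n≡m%n r t (suc n)) (m<n⇒m%n≡m r<n))
    periodic : seq μ (i + (r + t * suc n)) ≡ encSeq λ′ (i + r)
    periodic = trans (seq≡ _)
      (trans (if-false (<ᵇ-false (m≤m+n i _))) (cong (λ x → encSeq λ′ (i + x)) residue))
  below : BarsBelow i μ
  below p barred with p <? i
  ... | yes p<i = p<i
  ... | no  p≮i with () ← trans (sym (if-false (<ᵇ-false (≮⇒≥ p≮i)))) (trans (sym (bar≡ p)) barred)

BSinf-drop-FinitelyBranching : ∀ μ → InBSinf μ → ∀ k m → FinitelyBranching m (dropBS k μ)
BSinf-drop-FinitelyBranching μ μ∈BS∞ k m with D , B , dense , below ← BSinf⇒Dense∧BarsBelow μ μ∈BS∞ =
  Dense∧BarsBelow⇒FinitelyBranching m B (dropBS k μ)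
    (Dense-drop {f = seq μ} dense k) (BarsBelow-drop {μ = μ} below k)

-- The polynomials u_k

sum-map-cong-∈ : ∀ (J : List ℕ) {f g : ℕ → ℕ} → (∀ x → x ∈ J → f x ≡ g x) →
  sum (map f J) ≡ sum (map g J)
sum-map-cong-∈ J f≗g = cong sum (map-cong-local (All.tabulate (λ {x} → f≗g x)))

sum-map-++ : ∀ (f : ℕ → ℕ) xs ys → sum (map f (xs ++ ys)) ≡ sum (map f xs) + sum (map f ys)
sum-map-++ f xs ys = trans (cong sum (map-++ f xs ys)) (sum-++ (map f xs) (map f ys))

sum-map-+ : ∀ (f g : ℕ → ℕ) J → sum (map (λ x → f x + g x) J) ≡ sum (map f J) + sum (map g J)
sum-map-+ f g []      = refl
sum-map-+ f g (x ∷ J) = trans (cong (λ z → f x + g x + z) (sum-map-+ f g J))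
  (solve 4 (λ a b c d → (a :+ b) :+ (c :+ d) := (a :+ c) :+ (b :+ d)) refl
     (f x) (g x) (sum (map f J)) (sum (map g J)))
  where open +-*-Solver

sum-map-*ˡ : ∀ a (f : ℕ → ℕ) J → sum (map (λ x → a * f x) J) ≡ a * sum (map f J)
sum-map-*ˡ a f []      = sym (*-zeroʳ a)
sum-map-*ˡ a f (x ∷ J) = trans (cong (λ z → a * f x + z) (sum-map-*ˡ a f J)) (sym (*-distribˡ-+ a (f x) _))

infixl 7 _⊛_

_⊛_ : (ℕ → ℕ) → (ℕ → ℕ) → ℕ → ℕ
(A ⊛ B) zero    = A 0 * B 0
(A ⊛ B) (suc m) = A (suc m) * B 0 + (A ⊛ (B ∘ suc)) m

ones : ℕ → ℕ → ℕ
ones r       zero    = 1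
ones zero    (suc m) = 0
ones (suc r) (suc m) = ones r m

-- Polynomials are their coefficient sequences; ones r is 1 + x + ⋯ + xʳ, fusePoly k is u_k and
-- fuseSum k r is Σ_{j<k} u_j (1 + x + ⋯ + x^{r+k-1-j}).
fusePoly : ℕ → ℕ → ℕ
fuseSum  : ℕ → ℕ → ℕ → ℕ

fusePoly k zero    = 1
fusePoly k (suc m) = fuseSum k 0 m

fuseSum zero    r m = 0
fuseSum (suc k) r m = (fusePoly k ⊛ ones r) m + fuseSum k (suc r) m

⊛-congʳ : ∀ A {B B′ : ℕ → ℕ} → (∀ t → B t ≡ B′ t) → ∀ m → (A ⊛ B) m ≡ (A ⊛ B′) m
⊛-congʳ A B≗B′ zero    = cong (A 0 *_) (B≗B′ 0)
⊛-congʳ A B≗B′ (suc m) = cong₂ _+_ (cong (A (suc m) *_) (B≗B′ 0)) (⊛-congʳ A (B≗B′ ∘ suc) m)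

sum-⊛ : ∀ A (J : List ℕ) (F : ℕ → ℕ → ℕ) m →
  sum (map (λ j → (A ⊛ F j) m) J) ≡ (A ⊛ (λ t → sum (map (λ j → F j t) J))) m
sum-⊛ A J F zero    = sum-map-*ˡ (A 0) (λ j → F j 0) J
sum-⊛ A J F (suc m) = trans (sum-map-+ (λ j → A (suc m) * F j 0) (λ j → (A ⊛ (F j ∘ suc)) m) J)
  (cong₂ _+_ (sum-map-*ˡ (A (suc m)) (λ j → F j 0) J) (sum-⊛ A J (λ j → F j ∘ suc) m))

fusePoly-0-⊛ : ∀ B m → (fusePoly 0 ⊛ B) m ≡ B m
fusePoly-0-⊛ B zero    = +-identityʳ (B 0)
fusePoly-0-⊛ B (suc m) = fusePoly-0-⊛ (B ∘ suc) m

fuseSum-downFrom : ∀ k r m →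
  fuseSum k r m ≡ sum (map (λ j → (fusePoly j ⊛ ones (r + (k ∸ suc j))) m) (downFrom k))
fuseSum-downFrom zero    r m = refl
fuseSum-downFrom (suc k) r m = cong₂ _+_
  (cong (λ x → (fusePoly k ⊛ ones x) m) (sym (trans (cong (λ x → r + x) (n∸n≡0 k)) (+-identityʳ r))))
  (trans (fuseSum-downFrom k (suc r) m) (sum-map-cong-∈ (downFrom k) λ j j∈ →
     cong (λ x → (fusePoly j ⊛ ones x) m)
       (sym (trans (cong (λ x → r + x) (+-∸-assoc 1 (∈-downFrom⁻ j∈))) (+-suc r _)))))

fusePoly-suc-⊛ : ∀ k m (h : ℕ → ℕ) (hs : ℕ → ℕ → ℕ) (J : List ℕ) → h 0 ≡ 1 →
  (∀ t → sum (map (λ j → hs j t) J) ≡ h (suc t)) →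
  sum (map (λ j → (fusePoly j ⊛ ones (k ∸ j)) m) (downFrom (suc k)))
    + sum (map (λ j → (fusePoly (suc k) ⊛ hs j) m) J)
  ≡ (fusePoly (suc k) ⊛ h) (suc m)
fusePoly-suc-⊛ k m h hs J h0≡1 hs-sum = begin
  sum (map (λ j → (U j ⊛ ones (k ∸ j)) m) (downFrom (suc k))) + sum (map (λ j → (U (suc k) ⊛ hs j) m) J)
    ≡⟨ cong₂ _+_ (sym (fuseSum-downFrom (suc k) 0 m)) (sum-⊛ (U (suc k)) J hs m) ⟩
  U (suc k) (suc m) + (U (suc k) ⊛ (λ t → sum (map (λ j → hs j t) J))) m
    ≡⟨ cong₂ _+_ (sym (trans (cong (U (suc k) (suc m) *_) h0≡1) (*-identityʳ _)))
                 (⊛-congʳ (U (suc k)) hs-sum m) ⟩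
  U (suc k) (suc m) * h 0 + (U (suc k) ⊛ (h ∘ suc)) m
    ∎
  where
  U = fusePoly
  open ≡-Reasoning

-- Fuses and chains

Small : ℕ → Set
Small x = x ≡ 1 ⊎ x ≡ 2

FuseShape : ℕ → (ℕ → ℕ) → Set
FuseShape k s = (∀ t → suc t < k → Small (s t)) × 3 ≤ s (k ∸ 1) ×
                (∀ t → suc t < k → ¬ (s t ≡ 1 × s (suc t) ≡ 1))

fuseShape : ∀ {k μ} → IsFuse k μ → FuseShape k (seq μ)
fuseShape (small , big , _ , no11) = small , big , no11

-- A chain of length r is what remains of a fuse when only its first position stays barred;
-- its legal move sequences are 0 ∷ ⋯ ∷ 0 of length at most r.
Chain : ℕ → BarSeq → Set
Chain zero    ρ = ∀ i → bar ρ i ≡ false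
Chain (suc r) ρ = FuseShape (suc r) (seq ρ) × bar ρ 0 ≡ true × (∀ i → bar ρ (suc i) ≡ false)

Small-pos : ∀ {x} → Small x → 1 ≤ x
Small-pos (inj₁ refl) = s≤s z≤n
Small-pos (inj₂ refl) = s≤s z≤n

Small-<3 : ∀ {x} → Small x → x < 3
Small-<3 (inj₁ refl) = s≤s (s≤s z≤n)
Small-<3 (inj₂ refl) = s≤s (s≤s (s≤s z≤n))

Small-pair-≥3 : ∀ {a b} → Small a → Small b → ¬ (a ≡ 1 × b ≡ 1) → 3 ≤ a + b
Small-pair-≥3 (inj₁ refl) (inj₁ refl) no11 = ⊥-elim (no11 (refl , refl))
Small-pair-≥3 (inj₁ refl) (inj₂ refl) _    = s≤s (s≤s (s≤s z≤n))
Small-pair-≥3 (inj₂ refl) (inj₁ refl) _    = s≤s (s≤s (s≤s z≤n))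
Small-pair-≥3 (inj₂ refl) (inj₂ refl) _    = s≤s (s≤s (s≤s z≤n))

last-index : ∀ {t k} → t < suc k → ¬ suc t < suc k → t ≡ k
last-index t<k+1 t+1≮k+1 = ≤-antisym (≤-pred t<k+1) (≤-pred (≮⇒≥ t+1≮k+1))

FuseShape-pos : ∀ {k s} → FuseShape k s → ∀ t → t < k → 1 ≤ s t
FuseShape-pos {suc k} {s} (small , big , _) t t<k with suc t <? suc k
... | yes t+1<k = Small-pos (small t t+1<k)
... | no  t+1≮k = subst (λ x → 1 ≤ s x) (sym (last-index t<k t+1≮k)) (≤-trans (s≤s z≤n) big)

FuseShape-pair : ∀ {k s} → FuseShape k s → ∀ t → suc t < k → 3 ≤ s t + s (suc t)
FuseShape-pair {suc k} {s} (small , big , no11) t t+1<k with suc (suc t) <? suc k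
... | yes t+2<k = Small-pair-≥3 (small t t+1<k) (small (suc t) t+2<k) (no11 t t+1<k)
... | no  t+2≮k = ≤-trans (subst (λ x → 3 ≤ s x) (sym (last-index t+1<k t+2≮k)) big) (m≤n+m _ _)

FuseShape-drop : ∀ j r {s} → FuseShape (j + suc r) s → FuseShape (suc r) (λ i → s (j + i))
FuseShape-drop j r {s} (small , big , no11) =
  (λ t t+1<r+1 → small (j + t) (shift t+1<r+1)) ,
  subst (λ x → 3 ≤ s x) (cong (_∸ 1) (+-suc j r)) big ,
  (λ t t+1<r+1 → subst (λ x → ¬ (s (j + t) ≡ 1 × s x ≡ 1)) (sym (+-suc j t)) (no11 (j + t) (shift t+1<r+1)))
  where
  shift : ∀ {t} → suc t < suc r → suc (j + t) < j + suc r
  shift {t} t+1<r+1 = subst₂ _<_ (+-suc j t) refl (+-monoʳ-< j t+1<r+1)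

FuseShape-prefix : ∀ {k s s′} j → FuseShape k s → suc j ≤ k → (∀ t → suc t < suc j → s′ t ≡ s t) →
  3 ≤ s′ j → FuseShape (suc j) s′
FuseShape-prefix {k} {s′ = s′} j (small , _ , no11) j<k agree big′ = small′ , big′ , no11′
  where
  below : ∀ {t} → suc t < suc j → suc t < k
  below t+1<j+1 = <-≤-trans t+1<j+1 j<k
  small′ : ∀ t → suc t < suc j → Small (s′ t)
  small′ t t+1<j+1 = subst Small (sym (agree t t+1<j+1)) (small t (below t+1<j+1))
  no11′ : ∀ t → suc t < suc j → ¬ (s′ t ≡ 1 × s′ (suc t) ≡ 1)
  no11′ t t+1<j+1 (s′t≡1 , s′t+1≡1) with suc (suc t) <? suc j
  ... | yes t+2<j+1 = no11 t (below t+1<j+1)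
                        (trans (sym (agree t t+1<j+1)) s′t≡1 , trans (sym (agree (suc t) t+2<j+1)) s′t+1≡1)
  ... | no  t+2≮j+1 = <⇒≢ (≤-trans (s≤s (s≤s z≤n)) big″) (sym s′t+1≡1)
    where
    big″ : 3 ≤ s′ (suc t)
    big″ = subst (λ x → 3 ≤ s′ x) (sym (last-index t+1<j+1 t+2≮j+1)) big′

FuseShape⇒IsFuse-move : ∀ ρ n {j} → FuseShape (suc j) (moveSeq n (seq ρ)) → suc j ≤ n →
  IsFuse (suc j) (move n ρ)
FuseShape⇒IsFuse-move ρ n {j} shape@(small , big , no11) j<n = small , big , barred , no11
  where
  barred : ∀ t → t < suc j → bar (move n ρ) t ≡ true
  barred t t<j = trans (bar-move-before n ρ t (<-≤-trans t<j j<n)) (nz-pos (FuseShape-pos shape t t<j))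

move-0-Chain : ∀ r ρ → FuseShape (suc r) (seq ρ) → Chain r (move 0 ρ)
move-0-Chain zero ρ (_ , big , _) i =
  bar-move-after-false 0 ρ i z≤n (≤-trans big (m≤m+n _ _))
move-0-Chain (suc r) ρ shape@(small , _ , _) =
  FuseShape-drop 1 r shape , barred , unbarred
  where
  barred : bar (move 0 ρ) 0 ≡ true
  barred = trans (bar-move-after 0 ρ 0 z≤n) (cong₂ _∧_ (nz-pos (FuseShape-pos shape 1 (s≤s (s≤s z≤n))))
             (<ᵇ-true (subst (_< 3) (sym (+-identityʳ _)) (Small-<3 (small 0 (s≤s (s≤s z≤n)))))))
  unbarred : ∀ i → bar (move 0 ρ) (suc i) ≡ false
  unbarred i = bar-move-after-false 0 ρ (suc i) z≤n
    (≤-trans (FuseShape-pair shape 0 (s≤s (s≤s z≤n))) (+-monoʳ-≤ (seq ρ 0) (m≤m+n (seq ρ 1) _)))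

sumFrom-suc : ∀ (s : ℕ → ℕ) a c → sumFrom s (suc a) c ≡ sumFrom (s ∘ suc) a c
sumFrom-suc s a zero    = refl
sumFrom-suc s a (suc c) = cong (λ x → s (suc a) + x) (sumFrom-suc s (suc a) c)

moveSeq-drop : ∀ k j (s : ℕ → ℕ) i → moveSeq (k + j) s (k + i) ≡ moveSeq j (λ x → s (k + x)) i
moveSeq-drop zero    j s i = refl
moveSeq-drop (suc k) j s i = moveSeq-drop k j (s ∘ suc) i

bar-move-drop : ∀ k j ρ i → bar (move (k + j) ρ) (k + i) ≡ bar (move j (dropBS k ρ)) i
bar-move-drop zero    j ρ i = refl
bar-move-drop (suc k) j ρ i
  rewrite sumFrom-suc (seq ρ) (k + j) (suc (k + i ∸ (k + j))) = bar-move-drop k j (dropBS 1 ρ) i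

drop-move-comm : ∀ k j ρ → dropBS k (move (k + j) ρ) ≋ move j (dropBS k ρ)
drop-move-comm k j ρ = moveSeq-drop k j (seq ρ) , bar-move-drop k j ρ

drop-move-at : ∀ j ρ → dropBS j (move j ρ) ≋ move 0 (dropBS j ρ)
drop-move-at j ρ =
  subst (λ n → dropBS j (move n ρ) ≋ move 0 (dropBS j ρ)) (+-identityʳ j) (drop-move-comm j 0 ρ)

IsFuse-move-beyond : ∀ k j ρ → IsFuse (suc k) ρ → IsFuse (suc k) (move (suc k + j) ρ)
IsFuse-move-beyond k j ρ fuse = FuseShape⇒IsFuse-move ρ n shape′ k<n
  where
  n = suc k + j
  k<n : suc k ≤ n
  k<n = m≤m+n (suc k) j
  shape′ : FuseShape (suc k) (moveSeq n (seq ρ))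
  shape′ = FuseShape-prefix k (fuseShape fuse) ≤-refl
    (λ t t+1<k+1 → moveSeq-before n (seq ρ) t (<-≤-trans t+1<k+1 k<n))
    (≤-trans (proj₁ (proj₂ (fuseShape fuse))) (moveSeq-≥-here n (seq ρ) k k<n))

IsFuse-move-inside : ∀ j r ρ → IsFuse (suc j + suc r) ρ → IsFuse (suc j) (move (suc j) ρ)
IsFuse-move-inside j r ρ fuse = FuseShape⇒IsFuse-move ρ (suc j) shape′ ≤-refl
  where
  j<k : suc j < suc j + suc r
  j<k = m<m+n (suc j) (s≤s z≤n)
  shape′ : FuseShape (suc j) (moveSeq (suc j) (seq ρ))
  shape′ = FuseShape-prefix j (fuseShape fuse) (<⇒≤ j<k)
    (λ t t+1<j+1 → moveSeq-before (suc j) (seq ρ) t t+1<j+1)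
    (subst (3 ≤_) (sym (moveSeq-at (seq ρ) j)) (FuseShape-pair (fuseShape fuse) j j<k))

chainBars : ℕ → List ℕ
chainBars zero    = []
chainBars (suc r) = 0 ∷ []

Chain-enumerates : ∀ r ρ → Chain r ρ → Enumerates (chainBars r) (bar ρ)
Chain-enumerates zero ρ unbarred = [] , λ j → mk⇔ (λ ()) λ b → case trans (sym (unbarred j)) b of λ ()
Chain-enumerates (suc r) ρ (_ , barred , unbarred) = [] ∷ [] , λ j → mk⇔ (λ { (here refl) → barred }) (first j)
  where
  first : ∀ j → bar ρ j ≡ true → j ∈ 0 ∷ []
  first zero    _ = here refl
  first (suc i) b = case trans (sym (unbarred i)) b of λ ()

Chain-FinitelyBranching : ∀ r ρ → Chain r ρ → ∀ m → FinitelyBranching m ρ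
Chain-FinitelyBranching r ρ chain zero = tt
Chain-FinitelyBranching zero ρ unbarred (suc m) =
  [] , Chain-enumerates zero ρ unbarred , λ j b → case trans (sym (unbarred j)) b of λ ()
Chain-FinitelyBranching (suc r) ρ chain@(shape , _ , unbarred) (suc m) =
  0 ∷ [] , Chain-enumerates (suc r) ρ chain , next
  where
  next : ∀ j → bar ρ j ≡ true → FinitelyBranching m (move j ρ)
  next zero    _ = Chain-FinitelyBranching r (move 0 ρ) (move-0-Chain r ρ shape) m
  next (suc i) b = case trans (sym (unbarred i)) b of λ ()

Chain-LevelCount : ∀ r ρ → Chain r ρ → ∀ m → LevelCount ρ m (ones r m)
Chain-LevelCount r ρ chain zero = LevelCount-zero ρ
Chain-LevelCount zero ρ unbarred (suc m) =
  LevelCount-suc ρ m (λ _ → 0) [] (Chain-enumerates zero ρ unbarred) λ _ ()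
Chain-LevelCount (suc r) ρ chain@(shape , _) (suc m) =
  subst (LevelCount ρ (suc m)) (+-identityʳ (ones r m))
    (LevelCount-suc ρ m (λ _ → ones r m) (0 ∷ []) (Chain-enumerates (suc r) ρ chain)
      λ { _ (here refl) → Chain-LevelCount r (move 0 ρ) (move-0-Chain r ρ shape) m })

-- The factorisation

glue : ℕ → (ℕ → ℕ) → (ℕ → ℕ) → ℕ → ℕ
glue K f g j = if j <ᵇ K then f j else g (j ∸ K)

glue-below : ∀ K f g j → j < K → glue K f g j ≡ f j
glue-below K f g j j<K = if-true (<ᵇ-true j<K)

glue-beyond : ∀ K f g j → glue K f g (K + j) ≡ g j
glue-beyond K f g j = trans (if-false (<ᵇ-false (m≤m+n K j))) (cong g (m+n∸m≡n K j))

sum-map-glue : ∀ K f g J →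
  sum (map (glue K f g) (downFrom K ++ map (λ x → K + x) J)) ≡ sum (map f (downFrom K)) + sum (map g J)
sum-map-glue K f g J = trans (sum-map-++ (glue K f g) (downFrom K) _) (cong₂ _+_
  (sum-map-cong-∈ (downFrom K) λ j j∈K → glue-below K f g j (∈-downFrom⁻ j∈K))
  (trans (cong sum (sym (map-∘ J))) (sum-map-cong-∈ J λ j _ → glue-beyond K f g j)))

fuse-enumerates : ∀ k μ {Jν} → IsFuse k μ → Enumerates Jν (bar (dropBS k μ)) →
  Enumerates (downFrom k ++ map (λ x → k + x) Jν) (bar μ)
fuse-enumerates k μ {Jν} (_ , _ , barred , _) (uν , Jν⇔) =
  Unique.++⁺ (Unique.downFrom⁺ k) (Unique.map⁺ (λ {x} {y} → +-cancelˡ-≡ k x y) uν) disjoint ,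
  λ j → mk⇔ (sound j) (complete j)
  where
  disjoint : ∀ {j} → ¬ (j ∈ downFrom k × j ∈ map (λ x → k + x) Jν)
  disjoint (j∈k , j∈ν) with x , _ , refl ← ∈-map⁻ (λ x → k + x) j∈ν =
    <-irrefl refl (≤-<-trans (m≤m+n k x) (∈-downFrom⁻ j∈k))
  sound : ∀ j → j ∈ downFrom k ++ map (λ x → k + x) Jν → bar μ j ≡ true
  sound j j∈ with ∈-++⁻ (downFrom k) j∈
  ... | inj₁ j∈k = barred j (∈-downFrom⁻ j∈k)
  ... | inj₂ j∈ν with x , x∈Jν , refl ← ∈-map⁻ (λ x → k + x) j∈ν = to (Jν⇔ x) x∈Jν
  complete : ∀ j → bar μ j ≡ true → j ∈ downFrom k ++ map (λ x → k + x) Jν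
  complete j b with j <? k
  ... | yes j<k = ∈-++⁺ˡ (∈-downFrom⁺ j<k)
  ... | no  j≮k = ∈-++⁺ʳ (downFrom k) (subst (_∈ map (λ x → k + x) Jν) k+[j∸k]≡j
                    (∈-map⁺ (λ x → k + x) (from (Jν⇔ (j ∸ k)) (trans (cong (bar μ) k+[j∸k]≡j) b))))
    where
    k+[j∸k]≡j : k + (j ∸ k) ≡ j
    k+[j∸k]≡j = m+[n∸m]≡n (≮⇒≥ j≮k)

moves-LevelCount : ∀ ρ → (∀ t → FinitelyBranching t ρ) →
  Σ (List ℕ) λ J → Enumerates J (bar ρ) × Σ (ℕ → ℕ → ℕ) λ hs → ∀ j → j ∈ J →
    (∀ t → FinitelyBranching t (move j ρ)) × (∀ t → LevelCount (move j ρ) t (hs j t))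
moves-LevelCount ρ branching with J , enum , _ ← branching 1 =
  J , enum , finite-choice {P = Counted} (λ _ → 0) J counted
  where
  Counted : ℕ → (ℕ → ℕ) → Set
  Counted j H = (∀ t → FinitelyBranching t (move j ρ)) × (∀ t → LevelCount (move j ρ) t (H t))
  counted : ∀ j → j ∈ J → Σ (ℕ → ℕ) (Counted j)
  counted j j∈J = (λ t → proj₁ (levelCount t (move j ρ) (moved t))) , moved ,
                  (λ t → proj₂ (levelCount t (move j ρ) (moved t)))
    where
    moved : ∀ t → FinitelyBranching t (move j ρ)
    moved t = proj₂ (proj₂ (branching (suc t))) j (to (proj₂ enum j) j∈J)

Factorises : ℕ → Set
Factorises k = ∀ μ (h : ℕ → ℕ) → IsFuse k μ → (∀ t → FinitelyBranching t (dropBS k μ)) →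
  (∀ t → LevelCount (dropBS k μ) t (h t)) → ∀ m → LevelCount μ m ((fusePoly k ⊛ h) m)

module _ (k : ℕ) (shorter : ∀ {j} → j < k → Factorises (suc j)) where

  move-inside-LevelCount : ∀ μ → IsFuse (suc k) μ → ∀ j → j < suc k → ∀ m →
    LevelCount (move j μ) m ((fusePoly j ⊛ ones (k ∸ j)) m)
  move-inside-LevelCount μ fuse zero _ m =
    subst (LevelCount (move 0 μ) m) (sym (fusePoly-0-⊛ (ones k) m))
      (Chain-LevelCount k (move 0 μ) (move-0-Chain k μ (fuseShape fuse)) m)
  move-inside-LevelCount μ fuse (suc j) j+1<k+1 m =
    shorter j<k (move (suc j) μ) (ones r) (IsFuse-move-inside j r μ fuse′)
      (λ t → FinitelyBranching-cong t rest≋ (Chain-FinitelyBranching r _ rest t))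
      (λ t → LevelCount-cong rest≋ (Chain-LevelCount r _ rest t)) m
    where
    j<k = ≤-pred j+1<k+1
    r = k ∸ suc j
    fuse′ : IsFuse (suc j + suc r) μ
    fuse′ = subst (λ n → IsFuse n μ) (cong suc (sym (trans (+-suc j r) (m+[n∸m]≡n j<k)))) fuse
    rest : Chain r (move 0 (dropBS (suc j) μ))
    rest = move-0-Chain r (dropBS (suc j) μ) (FuseShape-drop (suc j) r (fuseShape fuse′))
    rest≋ : move 0 (dropBS (suc j) μ) ≋ dropBS (suc j) (move (suc j) μ)
    rest≋ = ≋-sym (drop-move-at (suc j) μ)

  factorises : Factorises (suc k)
  factorises μ h fuse branching counts zero =
    subst (λ x → LevelCount μ 0 (1 * x)) (LevelCount-unique (LevelCount-zero _) (counts 0)) (LevelCount-zero μ)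
  factorises μ h fuse branching counts (suc m)
    with Jν , enumν , hs , moves ← moves-LevelCount (dropBS (suc k) μ) branching =
    subst (LevelCount μ (suc m)) total
      (LevelCount-suc μ m (glue K inside beyond) J (fuse-enumerates K μ fuse enumν) move-count)
    where
    K = suc k
    J = downFrom K ++ map (λ x → K + x) Jν
    inside beyond : ℕ → ℕ
    inside j = (fusePoly j ⊛ ones (k ∸ j)) m
    beyond j = (fusePoly K ⊛ hs j) m
    move-beyond-LevelCount : ∀ j → j ∈ Jν → LevelCount (move (K + j) μ) m (beyond j)
    move-beyond-LevelCount j j∈Jν =
      factorises (move (K + j) μ) (hs j) (IsFuse-move-beyond k j μ fuse)
        (λ t → FinitelyBranching-cong t (≋-sym (drop-move-comm K j μ)) (proj₁ (moves j j∈Jν) t))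
        (λ t → LevelCount-cong (≋-sym (drop-move-comm K j μ)) (proj₂ (moves j j∈Jν) t)) m
    move-count : ∀ j → j ∈ J → LevelCount (move j μ) m (glue K inside beyond j)
    move-count j j∈J with ∈-++⁻ (downFrom K) j∈J
    ... | inj₁ j∈K = subst (LevelCount (move j μ) m) (sym (glue-below K inside beyond j (∈-downFrom⁻ j∈K)))
                       (move-inside-LevelCount μ fuse j (∈-downFrom⁻ j∈K) m)
    ... | inj₂ j∈ν with j′ , j′∈Jν , refl ← ∈-map⁻ (λ x → K + x) j∈ν =
      subst (LevelCount (move (K + j′) μ) m) (sym (glue-beyond K inside beyond j′)) (move-beyond-LevelCount j′ j′∈Jν)
    h0≡1 : h 0 ≡ 1
    h0≡1 = LevelCount-unique (counts 0) (LevelCount-zero _)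
    hs-sum : ∀ t → sum (map (λ j → hs j t) Jν) ≡ h (suc t)
    hs-sum t = LevelCount-unique
      (LevelCount-suc (dropBS K μ) t (λ j → hs j t) Jν enumν (λ j j∈Jν → proj₂ (moves j j∈Jν) t))
      (counts (suc t))
    total : sum (map (glue K inside beyond) J) ≡ (fusePoly K ⊛ h) (suc m)
    total = trans (sum-map-glue K inside beyond Jν) (fusePoly-suc-⊛ k m h hs Jν h0≡1 hs-sum)

fuse-factorises : ∀ k → Factorises (suc k)
fuse-factorises = <-rec (Factorises ∘ suc) factorises

-- Degree and integer coefficients

ones-vanishes : ∀ r b → r < b → ones r b ≡ 0
ones-vanishes zero    (suc b) _         = refl
ones-vanishes (suc r) (suc b) (s≤s r<b) = ones-vanishes r b r<b

⊛-vanishesʳ : ∀ A {B : ℕ → ℕ} → (∀ b → B b ≡ 0) → ∀ m → (A ⊛ B) m ≡ 0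
⊛-vanishesʳ A B≡0 zero    = trans (cong (A 0 *_) (B≡0 0)) (*-zeroʳ (A 0))
⊛-vanishesʳ A B≡0 (suc m) =
  cong₂ _+_ (trans (cong (A (suc m) *_) (B≡0 0)) (*-zeroʳ (A (suc m)))) (⊛-vanishesʳ A (B≡0 ∘ suc) m)

⊛-vanishes : ∀ {A : ℕ → ℕ} p → (∀ a → p < a → A a ≡ 0) → ∀ q {B : ℕ → ℕ} → (∀ b → q < b → B b ≡ 0) →
  ∀ m → p + q < m → (A ⊛ B) m ≡ 0
⊛-vanishes {A} p A≡0 zero {B} B≡0 (suc m) p+0<m+1 =
  cong₂ _+_ (cong (_* B 0) (A≡0 (suc m) (≤-trans (s≤s (m≤m+n p 0)) p+0<m+1)))
            (⊛-vanishesʳ A (λ b → B≡0 (suc b) (s≤s z≤n)) m)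
⊛-vanishes {A} p A≡0 (suc q) {B} B≡0 (suc m) p+q+1<m+1 =
  cong₂ _+_ (cong (_* B 0) (A≡0 (suc m) (≤-trans (s≤s (m≤m+n p (suc q))) p+q+1<m+1)))
            (⊛-vanishes p A≡0 q (λ b q<b → B≡0 (suc b) (s≤s q<b)) m
               (≤-pred (subst (_< suc m) (+-suc p q) p+q+1<m+1)))

fusePoly-vanishes : ∀ k a → k < a → fusePoly k a ≡ 0
fuseSum-vanishes  : ∀ k r m → k + r ≤ m → fuseSum k r m ≡ 0

fusePoly-vanishes k (suc m) k<m+1 = fuseSum-vanishes k 0 m (subst (_≤ m) (sym (+-identityʳ k)) (≤-pred k<m+1))

fuseSum-vanishes zero    r m _       = refl
fuseSum-vanishes (suc k) r m k+r<m =
  cong₂ _+_ (⊛-vanishes k (fusePoly-vanishes k) r (ones-vanishes r) m k+r<m)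
            (fuseSum-vanishes k (suc r) m (subst (_≤ m) (sym (+-suc k r)) k+r<m))

coeff-applyUpTo : ∀ n (F : ℕ → ℤ) a → (n ≤ a → F a ≡ + 0) → coeff (applyUpTo F n) a ≡ F a
coeff-applyUpTo zero    F a       F≡0 = sym (F≡0 z≤n)
coeff-applyUpTo (suc n) F zero    _   = refl
coeff-applyUpTo (suc n) F (suc a) F≡0 = coeff-applyUpTo n (F ∘ suc) a (F≡0 ∘ s≤s)

convAuxℕ : (ℕ → ℕ) → (ℕ → ℕ) → ℕ → ℕ → ℕ
convAuxℕ A h m zero    = A 0 * h m
convAuxℕ A h m (suc a) = A (suc a) * h (m ∸ suc a) + convAuxℕ A h m a

convAux-+ : ∀ u A h m → (∀ a → coeff u a ≡ + A a) → ∀ a → convAux u h m a ≡ + convAuxℕ A h m a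
convAux-+ u A h m u≡A zero =
  trans (cong (λ z → z ℤ.* + h m) (u≡A 0)) (sym (pos-* (A 0) (h m)))
convAux-+ u A h m u≡A (suc a) =
  trans (cong₂ ℤ._+_ (trans (cong (λ z → z ℤ.* + h (m ∸ suc a)) (u≡A (suc a))) (sym (pos-* (A (suc a)) _)))
                     (convAux-+ u A h m u≡A a))
        (sym (pos-+ (A (suc a) * h (m ∸ suc a)) (convAuxℕ A h m a)))

convAuxℕ-suc : ∀ A h m a → a ≤ m → convAuxℕ A h (suc m) a ≡ convAuxℕ A (h ∘ suc) m a
convAuxℕ-suc A h m zero    _   = refl
convAuxℕ-suc A h m (suc a) a<m =
  cong₂ _+_ (cong (λ x → A (suc a) * h x) (+-∸-assoc 1 a<m)) (convAuxℕ-suc A h m a (≤-trans (n≤1+n a) a<m))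

convAuxℕ-⊛ : ∀ m A h → convAuxℕ A h m m ≡ (A ⊛ h) m
convAuxℕ-⊛ zero    A h = refl
convAuxℕ-⊛ (suc m) A h = cong₂ _+_ (cong (λ x → A (suc m) * h x) (n∸n≡0 m))
  (trans (convAuxℕ-suc A h m m ≤-refl) (convAuxℕ-⊛ m A (h ∘ suc)))

conv-⊛ : ∀ u A h m → (∀ a → coeff u a ≡ + A a) → conv u h m ≡ + (A ⊛ h) m
conv-⊛ u A h m u≡A = trans (convAux-+ u A h m u≡A m) (cong +_ (convAuxℕ-⊛ m A h))

fusePolyCoeffs : ℕ → List ℤ
fusePolyCoeffs k = applyUpTo (λ a → + fusePoly k a) (suc k)

coeff-fusePolyCoeffs : ∀ k a → coeff (fusePolyCoeffs k) a ≡ + fusePoly k a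
coeff-fusePolyCoeffs k a = coeff-applyUpTo (suc k) (λ a → + fusePoly k a) a (cong +_ ∘ fusePoly-vanishes k a)

corollary3p8 : (k : ℕ) → 1 ≤ k →
    Σ (List ℤ) λ u →
      (μ : BarSeq) → InBSinf μ → IsFuse k μ →
        Σ (ℕ → ℕ) λ f → Σ (ℕ → ℕ) λ h →
          (∀ m → LevelCount μ m (f m)) ×
          (∀ m → LevelCount (dropBS k μ) m (h m)) ×
          (∀ m → + (f m) ≡ conv u h m)
corollary3p8 zero    ()
corollary3p8 (suc k) _ = fusePolyCoeffs (suc k) , λ μ μ∈BS∞ fuse →
  let branching = BSinf-drop-FinitelyBranching μ μ∈BS∞ (suc k)
      h t = proj₁ (levelCount t (dropBS (suc k) μ) (branching t))
      counts t = proj₂ (levelCount t (dropBS (suc k) μ) (branching t))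
  in fusePoly (suc k) ⊛ h , h , fuse-factorises k μ h fuse branching counts , counts ,
     λ m → sym (conv-⊛ (fusePolyCoeffs (suc k)) (fusePoly (suc k)) h m (coeff-fusePolyCoeffs (suc k)))
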